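{- Let $\varphi\in\mathrm{Fm}_{\mathsf S}$ and $a,b\in Ag$ with $a\neq b$. Then: (1) $\vdash_{\mathsf S}S_{a,b}\varphi\to I_aS_{a,b}\varphi$; (2) $\vdash_{\mathsf S}\neg S_{a,b}K_b\varphi\land\neg S_{a,b}I_b\varphi\land\neg S_{a,b}B_b\varphi$; (3) $\vdash_{\mathsf S}\neg I_aK_bS_{a,b}\varphi$.
   Context: Let $Ag$ be a non-empty finite set of agents and $Var$ a countably infinite set of propositional variables. The formulas $\mathrm{Fm}_{\mathsf S}$ are generated by $\varphi::=p\mid\neg\varphi\mid\varphi\land\varphi\mid I_a\varphi\mid K_a\varphi\mid B_a\varphi$ ($p\in Var$, $a\in Ag$), with $\lor,\to,\leftrightarrow$ classical abbreviations. The logic $\mathsf S$ ($\vdash_{\mathsf S}\varphi$ means $\varphi$ is derivable) has as axioms: all classical tautologies; for each $a$ and $\star\in\{K_a,B_a,I_a\}$, $\star(\varphi\to\psi)\to(\star\varphi\to\star\psi)$; $K_a\varphi\to\varphi$; $K_a\varphi\to K_aK_a\varphi$; $B_a\varphi\to\neg B_a\neg\varphi$; $K_a\varphi\to B_a\varphi$; $B_a\varphi\to K_aB_a\varphi$; $I_a\varphi\to\neg I_a\neg\varphi$; $I_a\varphi\to K_aI_a\varphi$; $I_a\varphi\to I_aK_a\varphi$; $I_a\varphi\to I_aI_a\varphi$; rules: modus ponens and necessitation for each $K_a,B_a,I_a$. For agents $a,b$ and a formula $\varphi$, $S_{a,b}\varphi:=K_a\varphi\land B_a\neg K_b\varphi\land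 I_a(\varphi\land\neg K_b\varphi)$. -}

module Defs where

open import Data.Nat using (ℕ; suc)
open import Data.Fin using (Fin)
open import Data.Bool using (Bool; true; false; not; _∧_)
open import Relation.Binary.PropositionalEquality using (_≡_)

-- Formulas over agents Fin (suc n) (a non-empty finite set) and
-- propositional variables ℕ (a countably infinite set).
data Fm (n : ℕ) : Set where
  var : ℕ → Fm n
  ¬'_ : Fm n → Fm n
  _∧'_ : Fm n → Fm n → Fm n
  I : Fin (suc n) → Fm n → Fm n
  K : Fin (suc n) → Fm n → Fm n
  B : Fin (suc n) → Fm n → Fm n

infixr 6 _∧'_
infixr 4 _→'_
infix 7 ¬'_

_∨'_ : ∀ {n} → Fm n → Fm n → Fm n
φ ∨' ψ = ¬' (¬' φ ∧' ¬' ψ)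

_→'_ : ∀ {n} → Fm n → Fm n → Fm n
φ →' ψ = ¬' (φ ∧' ¬' ψ)

_↔'_ : ∀ {n} → Fm n → Fm n → Fm n
φ ↔' ψ = (φ →' ψ) ∧' (ψ →' φ)

-- Classical truth value: variables and modal formulas are treated as
-- propositional atoms, assigned a truth value by v.
tv : ∀ {n} → (Fm n → Bool) → Fm n → Bool
tv v (var p) = v (var p)
tv v (¬' φ) = not (tv v φ)
tv v (φ ∧' ψ) = tv v φ ∧ tv v ψ
tv v (I a φ) = v (I a φ)
tv v (K a φ) = v (K a φ)
tv v (B a φ) = v (B a φ)

-- φ is a classical tautology (substitution instance of a propositional tautology)
Tautology : ∀ {n} → Fm n → Set
Tautology φ = ∀ v → tv v φ ≡ true

data ⊢S_ {n : ℕ} : Fm n → Set where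
  taut : ∀ {φ} → Tautology φ → ⊢S φ
  K-K : ∀ a φ ψ → ⊢S (K a (φ →' ψ) →' (K a φ →' K a ψ))
  K-B : ∀ a φ ψ → ⊢S (B a (φ →' ψ) →' (B a φ →' B a ψ))
  K-I : ∀ a φ ψ → ⊢S (I a (φ →' ψ) →' (I a φ →' I a ψ))
  T-K : ∀ a φ → ⊢S (K a φ →' φ)
  4-K : ∀ a φ → ⊢S (K a φ →' K a (K a φ))
  D-B : ∀ a φ → ⊢S (B a φ →' ¬' B a (¬' φ))
  KB : ∀ a φ → ⊢S (K a φ →' B a φ)
  BKB : ∀ a φ → ⊢S (B a φ →' K a (B a φ))
  D-I : ∀ a φ → ⊢S (I a φ →' ¬' I a (¬' φ))
  IKI : ∀ a φ → ⊢S (I a φ →' K a (I a φ))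
  IIK : ∀ a φ → ⊢S (I a φ →' I a (K a φ))
  4-I : ∀ a φ → ⊢S (I a φ →' I a (I a φ))
  mp : ∀ {φ ψ} → ⊢S (φ →' ψ) → ⊢S φ → ⊢S ψ
  nec-K : ∀ a {φ} → ⊢S φ → ⊢S K a φ
  nec-B : ∀ a {φ} → ⊢S φ → ⊢S B a φ
  nec-I : ∀ a {φ} → ⊢S φ → ⊢S I a φ

infix 2 ⊢S_

S : ∀ {n} → Fin (suc n) → Fin (suc n) → Fm n → Fm n
S a b φ = K a φ ∧' (B a (¬' K b φ) ∧' I a (φ ∧' ¬' K b φ))

{-# OPTIONS --safe #-}
-- Each conjunct of S_{a,b} χ is recovered under I_a from its third conjunct
-- I_a(χ ∧ ¬K_b χ): IIK turns it into I_a K_a(χ ∧ ¬K_b χ), which yields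
-- I_a K_a χ and I_a B_a ¬K_b χ, while 4-I yields I_a I_a(χ ∧ ¬K_b χ).
-- That third conjunct is refutable (by seriality of I_a) as soon as
-- χ → K_b χ is provable, which the introspection axioms give for
-- χ = K_b φ, I_b φ, B_b φ.  Finally K_a K_b S_{a,b} φ would make a believe
-- both K_b φ and ¬K_b φ, so it is refutable, and by IIK so is I_a K_b S_{a,b} φ.
module Submission where

open import Defs
open import Data.Nat using (ℕ; zero; suc)
open import Data.Fin using (Fin)
open import Data.Bool using (Bool; true; false; not; _∧_)
open import Data.Bool.Properties using (∧-conicalˡ; ∧-conicalʳ)
open import Data.Product using (_×_; _,_)
open import Relation.Binary.PropositionalEquality using (_≡_; _≢_; refl)

BoolFun : ℕ → Set
BoolFun zero    = Bool
BoolFun (suc k) = Bool → BoolFun k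

allTrue : ∀ k → BoolFun k → Bool
allTrue zero    b = b
allTrue (suc k) f = allTrue k (f false) ∧ allTrue k (f true)

Valid : ∀ k → BoolFun k → Set
Valid zero    b = b ≡ true
Valid (suc k) f = ∀ x → Valid k (f x)

allTrue-sound : ∀ k (f : BoolFun k) → allTrue k f ≡ true → Valid k f
allTrue-sound zero    b eq       = eq
allTrue-sound (suc k) f eq false = allTrue-sound k (f false) (∧-conicalˡ _ _ eq)
allTrue-sound (suc k) f eq true  = allTrue-sound k (f true) (∧-conicalʳ _ _ eq)

infixr 4 _⇒_

-- Agrees definitionally with tv on _→'_, so a schema's truth table is checked by refl.
_⇒_ : Bool → Bool → Bool
x ⇒ y = not (x ∧ not y)

module _ {n : ℕ} where

  ∧-elimˡ : {φ ψ : Fm n} → ⊢S (φ ∧' ψ →' φ)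
  ∧-elimˡ {φ} {ψ} = taut λ v →
    allTrue-sound 2 (λ x y → x ∧ y ⇒ x) refl (tv v φ) (tv v ψ)

  ∧-elimʳ : {φ ψ : Fm n} → ⊢S (φ ∧' ψ →' ψ)
  ∧-elimʳ {φ} {ψ} = taut λ v →
    allTrue-sound 2 (λ x y → x ∧ y ⇒ y) refl (tv v φ) (tv v ψ)

  ∧-curried : {φ ψ : Fm n} → ⊢S (φ →' ψ →' φ ∧' ψ)
  ∧-curried {φ} {ψ} = taut λ v →
    allTrue-sound 2 (λ x y → x ⇒ y ⇒ x ∧ y) refl (tv v φ) (tv v ψ)

  ∧-intro : {φ ψ : Fm n} → ⊢S φ → ⊢S ψ → ⊢S (φ ∧' ψ)
  ∧-intro ⊢φ ⊢ψ = mp (mp ∧-curried ⊢φ) ⊢ψ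

  →-trans : {φ ψ χ : Fm n} → ⊢S (φ →' ψ) → ⊢S (ψ →' χ) → ⊢S (φ →' χ)
  →-trans {φ} {ψ} {χ} φ→ψ ψ→χ = mp (mp (taut λ v →
    allTrue-sound 3 (λ x y z → (x ⇒ y) ⇒ (y ⇒ z) ⇒ x ⇒ z) refl
      (tv v φ) (tv v ψ) (tv v χ)) φ→ψ) ψ→χ

  →-∧ : {φ ψ χ : Fm n} → ⊢S (φ →' ψ) → ⊢S (φ →' χ) → ⊢S (φ →' ψ ∧' χ)
  →-∧ {φ} {ψ} {χ} φ→ψ φ→χ = mp (mp (taut λ v →
    allTrue-sound 3 (λ x y z → (x ⇒ y) ⇒ (x ⇒ z) ⇒ x ⇒ y ∧ z) refl
      (tv v φ) (tv v ψ) (tv v χ)) φ→ψ) φ→χ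

  →-uncurry : {φ ψ χ : Fm n} → ⊢S (φ →' ψ →' χ) → ⊢S (φ ∧' ψ →' χ)
  →-uncurry {φ} {ψ} {χ} φ→ψ→χ = mp (taut λ v →
    allTrue-sound 3 (λ x y z → (x ⇒ y ⇒ z) ⇒ x ∧ y ⇒ z) refl
      (tv v φ) (tv v ψ) (tv v χ)) φ→ψ→χ

  ¬-intro : {φ ψ : Fm n} → ⊢S (φ →' ψ) → ⊢S (φ →' ¬' ψ) → ⊢S ¬' φ
  ¬-intro {φ} {ψ} φ→ψ φ→¬ψ = mp (mp (taut λ v →
    allTrue-sound 2 (λ x y → (x ⇒ y) ⇒ (x ⇒ not y) ⇒ not x) refl
      (tv v φ) (tv v ψ)) φ→ψ) φ→¬ψ

  modus-tollens : {φ ψ : Fm n} → ⊢S (φ →' ¬' ψ) → ⊢S ψ → ⊢S ¬' φ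
  modus-tollens {φ} {ψ} φ→¬ψ ⊢ψ = mp (mp (taut λ v →
    allTrue-sound 2 (λ x y → (x ⇒ not y) ⇒ y ⇒ not x) refl
      (tv v φ) (tv v ψ)) φ→¬ψ) ⊢ψ

  record IsNormal (□ : Fm n → Fm n) : Set where
    field
      distrib : ∀ φ ψ → ⊢S (□ (φ →' ψ) →' □ φ →' □ ψ)
      nec     : {φ : Fm n} → ⊢S φ → ⊢S □ φ

    mono : {φ ψ : Fm n} → ⊢S (φ →' ψ) → ⊢S (□ φ →' □ ψ)
    mono {φ} {ψ} φ→ψ = mp (distrib φ ψ) (nec φ→ψ)

    ∧-distrib : {φ ψ : Fm n} → ⊢S (□ φ ∧' □ ψ →' □ (φ ∧' ψ))
    ∧-distrib {φ} {ψ} =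
      →-uncurry (→-trans (mono ∧-curried) (distrib ψ (φ ∧' ψ)))

  K-normal : ∀ a → IsNormal (K a)
  K-normal a = record { distrib = K-K a ; nec = nec-K a }

  I-normal : ∀ a → IsNormal (I a)
  I-normal a = record { distrib = K-I a ; nec = nec-I a }

  module K a = IsNormal (K-normal a)
  module I a = IsNormal (I-normal a)

  B-inconsistent : ∀ a {χ φ : Fm n} →
    ⊢S (χ →' B a φ) → ⊢S (χ →' B a (¬' φ)) → ⊢S ¬' χ
  B-inconsistent a {φ = φ} χ→Bφ χ→B¬φ = ¬-intro χ→B¬φ (→-trans χ→Bφ (D-B a φ))

  ¬K⇒¬I : ∀ a {φ : Fm n} → ⊢S ¬' K a φ → ⊢S ¬' I a φ
  ¬K⇒¬I a {φ} ⊢¬Kφ = modus-tollens (→-trans (IIK a φ) (D-I a (K a φ))) (I.nec a ⊢¬Kφ)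

  module _ (a b : Fin (suc n)) {φ : Fm n} where

    S⇒K : ⊢S (S a b φ →' K a φ)
    S⇒K = ∧-elimˡ

    S⇒B : ⊢S (S a b φ →' B a (¬' K b φ))
    S⇒B = →-trans ∧-elimʳ ∧-elimˡ

    S⇒I : ⊢S (S a b φ →' I a (φ ∧' ¬' K b φ))
    S⇒I = →-trans ∧-elimʳ ∧-elimʳ

    S⇒IS : ⊢S (S a b φ →' I a (S a b φ))
    S⇒IS = →-trans (→-∧ S⇒IK (→-trans (→-∧ S⇒IB S⇒II) (I.∧-distrib a))) (I.∧-distrib a)
      where
      S⇒IKI : ⊢S (S a b φ →' I a (K a (φ ∧' ¬' K b φ)))
      S⇒IKI = →-trans S⇒I (IIK a _)

      S⇒IK : ⊢S (S a b φ →' I a (K a φ))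
      S⇒IK = →-trans S⇒IKI (I.mono a (K.mono a ∧-elimˡ))

      S⇒IB : ⊢S (S a b φ →' I a (B a (¬' K b φ)))
      S⇒IB = →-trans S⇒IKI (I.mono a (→-trans (K.mono a ∧-elimʳ) (KB a _)))

      S⇒II : ⊢S (S a b φ →' I a (I a (φ ∧' ¬' K b φ)))
      S⇒II = →-trans S⇒I (4-I a _)

    ¬KKS : ⊢S ¬' K a (K b (S a b φ))
    ¬KKS = B-inconsistent a KKS⇒BK KKS⇒B¬K
      where
      KKS⇒BK : ⊢S (K a (K b (S a b φ)) →' B a (K b φ))
      KKS⇒BK = →-trans (K.mono a (K.mono b (→-trans S⇒K (T-K a φ)))) (KB a _)

      KKS⇒B¬K : ⊢S (K a (K b (S a b φ)) →' B a (¬' K b φ))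
      KKS⇒B¬K = →-trans (T-K a _) (→-trans (T-K b _) S⇒B)

  introspective⇒¬S : ∀ a b {χ : Fm n} → ⊢S (χ →' K b χ) → ⊢S ¬' S a b χ
  introspective⇒¬S a b χ→Kχ = modus-tollens (→-trans (S⇒I a b) (D-I a _)) (I.nec a χ→Kχ)

proposition3 : ∀ {n : ℕ} (φ : Fm n) (a b : Fin (suc n)) → a ≢ b →
    (⊢S (S a b φ →' I a (S a b φ)))
    × (⊢S (¬' S a b (K b φ) ∧' (¬' S a b (I b φ) ∧' ¬' S a b (B b φ))))
    × (⊢S ¬' I a (K b (S a b φ)))
proposition3 φ a b _ =
    S⇒IS a b
  , ∧-intro (introspective⇒¬S a b (4-K b φ))
      (∧-intro (introspective⇒¬S a b (IKI b φ)) (introspective⇒¬S a b (BKB b φ)))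
  , ¬K⇒¬I a (¬KKS a b)
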